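{- Let $k\ge2$, $n\ge1$, let $f:\mathfrak T^n\to\mathbb R$ be $k$-submodular with $f(\mathbf 0)=0$, and let $(x,L)\in U(f)$. If $T,U\in\mathfrak F(x,L)$ and $i\in\operatorname{supp}(x)$ are such that $T_i,U_i\in\mathfrak L\setminus\{L_i\}$, then $T_i=U_i$.
   Context: $\mathfrak T$ is a set consisting of a root $\mathbf o$ and a set $\mathfrak L$ of exactly $k$ leaves. Binary operations $\sqcap,\sqcup$ on $\mathfrak T$: $t\sqcap t=t\sqcup t=t$; for distinct leaves $a,b$: $a\sqcap b=a\sqcup b=\mathbf o$; for a leaf $a$: $a\sqcap\mathbf o=\mathbf o\sqcap a=\mathbf o$, $a\sqcup\mathbf o=\mathbf o\sqcup a=a$; they act componentwise on $\mathfrak T^n$; $\mathbf 0=(\mathbf o,\dots,\mathbf o)$. $f$ is $k$-submodular if $f(T\sqcap U)+f(T\sqcup U)\le f(T)+f(U)$ for all $T,U$. For $(x,L)\in\mathbb R_{\ge0}^n\times\mathfrak L^n$, $\overline{(x,L)}(T)=\sum_i\overline{(x,L)}_i(T_i)$ with $\overline{(x,L)}_i(\mathbf o)=0$, $\overline{(x,L)}_i(L_i)=x_i$, $\overline{(x,L)}_i(\ell)=-x_i$ for leaves $\ell\ne L_i$. $U(f)=\{(x,L)\in\mathbb R_{\ge0}^n\times\mathfrak L^n:\overline{(x,L)}(T)\le f(T)\ \forall T\in\mathfrak T^n\}$. $\mathfrak F(x,L)=\{T\in\mathfrak T^n:\overline{(x,L)}(T)=f(T)\}$. $\operatorname{supp}(x)=\{i:x_i\neq0\}$.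 -}

module Defs where

open import Level using (Level) renaming (suc to lsuc; _⊔_ to _⊔ˡ_)
open import Data.Nat using (ℕ; zero; suc)
open import Data.Fin using (Fin; zero; suc)
open import Data.Fin.Properties using (_≟_)
open import Data.Product using (Σ; _×_)
open import Relation.Nullary using (¬_; yes; no)
open import Relation.Binary using (Rel; IsTotalOrder)
open import Algebra.Bundles using (CommutativeRing)

-- An ordered field (the real numbers ℝ are the intended instance):
-- a commutative ring with 0 ≉ 1, multiplicative inverses of nonzero
-- elements, and a total order compatible with + and *.
record OrderedField (c ℓ₁ ℓ₂ : Level) : Set (lsuc (c ⊔ˡ ℓ₁ ⊔ˡ ℓ₂)) where
  field
    commutativeRing : CommutativeRing c ℓ₁
  open CommutativeRing commutativeRing public
  field
    _≤_            : Rel Carrier ℓ₂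
    isTotalOrder   : IsTotalOrder _≈_ _≤_
    0≉1            : ¬ (0# ≈ 1#)
    inverse        : ∀ x → ¬ (x ≈ 0#) → Σ Carrier (λ y → (x * y) ≈ 1#)
    +-mono-≤       : ∀ {x y} z → x ≤ y → (x + z) ≤ (y + z)
    *-nonneg       : ∀ {x y} → 0# ≤ x → 0# ≤ y → 0# ≤ (x * y)

data 𝔗 (k : ℕ) : Set where
  o    : 𝔗 k
  leaf : Fin k → 𝔗 k

_⊓_ : ∀ {k} → 𝔗 k → 𝔗 k → 𝔗 k
o ⊓ _ = o
leaf a ⊓ o = o
leaf a ⊓ leaf b with a ≟ b
... | yes _ = leaf a
... | no _  = o

_⊔_ : ∀ {k} → 𝔗 k → 𝔗 k → 𝔗 k
o ⊔ t = t
leaf a ⊔ o = leaf a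
leaf a ⊔ leaf b with a ≟ b
... | yes _ = leaf a
... | no _  = o

Tn : ℕ → ℕ → Set
Tn k n = Fin n → 𝔗 k

_⊓ⁿ_ : ∀ {k n} → Tn k n → Tn k n → Tn k n
(T ⊓ⁿ U) i = T i ⊓ U i

_⊔ⁿ_ : ∀ {k n} → Tn k n → Tn k n → Tn k n
(T ⊔ⁿ U) i = T i ⊔ U i

𝟎 : ∀ {k n} → Tn k n
𝟎 _ = o

module _ {c ℓ₁ ℓ₂} (F : OrderedField c ℓ₁ ℓ₂) where
  open OrderedField F using (Carrier; _≈_; _≤_; _+_; -_; 0#)

  sumFin : ∀ n → (Fin n → Carrier) → Carrier
  sumFin zero    g = 0#
  sumFin (suc n) g = g zero + sumFin n (λ i → g (suc i))

  IsKSubmodular : ∀ {k n} → (Tn k n → Carrier) → Set ℓ₂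
  IsKSubmodular f = ∀ T U → (f (T ⊓ⁿ U) + f (T ⊔ⁿ U)) ≤ (f T + f U)

  xbarᵢ : ∀ {k} → Carrier → Fin k → 𝔗 k → Carrier
  xbarᵢ xi Li o = 0#
  xbarᵢ xi Li (leaf a) with a ≟ Li
  ... | yes _ = xi
  ... | no _  = - xi

  xbar : ∀ {k n} → (Fin n → Carrier) → (Fin n → Fin k) → Tn k n → Carrier
  xbar {n = n} x L T = sumFin n (λ i → xbarᵢ (x i) (L i) (T i))

  InU : ∀ {k n} → (Tn k n → Carrier) → (Fin n → Carrier) → (Fin n → Fin k) → Set ℓ₂
  InU f x L = (∀ i → 0# ≤ x i) × (∀ T → xbar x L T ≤ f T)

  InF : ∀ {k n} → (Tn k n → Carrier) → (Fin n → Carrier) → (Fin n → Fin k) → Tn k n → Set ℓ₁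
  InF f x L T = xbar x L T ≈ f T

  InSupp : ∀ {n} → (Fin n → Carrier) → Fin n → Set ℓ₁
  InSupp x i = ¬ (x i ≈ 0#)

-- The linear function x̄ is k-supermodular coordinatewise whenever x ≥ 0, and
-- at a coordinate i where T and U carry two distinct leaves other than Lᵢ the
-- supermodularity inequality has slack 2xᵢ.  For T, U tight this gives
-- x̄ T + x̄ U + 2xᵢ ≤ x̄ (T ⊓ U) + x̄ (T ⊔ U) ≤ f (T ⊓ U) + f (T ⊔ U) ≤ f T + f U
-- = x̄ T + x̄ U, hence xᵢ = 0, contradicting i ∈ supp x.
module Submission where

open import Defs
open import Level using (Level)
open import Data.Nat using (ℕ; zero; suc)
open import Data.Fin using (Fin; zero; suc)
open import Data.Fin.Properties using (_≟_)
open import Data.Product using (_,_)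
open import Data.Empty using (⊥-elim)
open import Relation.Nullary using (yes; no)
open import Relation.Binary.Bundles using (Poset)
open import Relation.Binary.Structures using (IsTotalOrder)
open import Relation.Binary.PropositionalEquality using (_≡_; _≢_; refl)
import Algebra.Properties.CommutativeSemigroup as CommutativeSemigroupProperties
import Relation.Binary.Reasoning.PartialOrder as PosetReasoning

module OrderedFieldProperties {c ℓ₁ ℓ₂} (F : OrderedField c ℓ₁ ℓ₂) where

  open OrderedField F public
    using ( Carrier; _≈_; _+_; -_; 0#; isTotalOrder; +-commutativeSemigroup
          ; +-comm; +-assoc; +-cong; +-congˡ; +-congʳ; +-identityˡ; +-identityʳ
          ; -‿inverseˡ; -‿inverseʳ )
    renaming (_≤_ to infix 4 _≤_; +-mono-≤ to +-monoˡ-≤; sym to ≈-sym; trans to ≈-trans)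
  open IsTotalOrder isTotalOrder public
    using (antisym) renaming (refl to ≤-refl; reflexive to ≤-reflexive)
  open CommutativeSemigroupProperties +-commutativeSemigroup public
    using (interchange; xy∙z≈xz∙y)

  poset : Poset c ℓ₁ ℓ₂
  poset = record { isPartialOrder = IsTotalOrder.isPartialOrder isTotalOrder }

  open PosetReasoning poset public

  +-monoʳ-≤ : ∀ z {x y} → x ≤ y → z + x ≤ z + y
  +-monoʳ-≤ z {x} {y} x≤y = begin
    z + x ≈⟨ +-comm z x ⟩
    x + z ≤⟨ +-monoˡ-≤ z x≤y ⟩
    y + z ≈⟨ +-comm y z ⟩
    z + y ∎

  +-mono-≤ : ∀ {x y u v} → x ≤ y → u ≤ v → x + u ≤ y + v
  +-mono-≤ {x} {y} {u} {v} x≤y u≤v = begin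
    x + u ≤⟨ +-monoˡ-≤ u x≤y ⟩
    y + u ≤⟨ +-monoʳ-≤ y u≤v ⟩
    y + v ∎

  neg-nonpos : ∀ {x} → 0# ≤ x → - x ≤ 0#
  neg-nonpos {x} 0≤x = begin
    - x      ≈⟨ +-identityˡ (- x) ⟨
    0# + - x ≤⟨ +-monoˡ-≤ (- x) 0≤x ⟩
    x + - x  ≈⟨ -‿inverseʳ x ⟩
    0#       ∎

  x+d≤x⇒d≤0 : ∀ x d → x + d ≤ x → d ≤ 0#
  x+d≤x⇒d≤0 x d x+d≤x = begin
    d                ≈⟨ +-identityʳ d ⟨
    d + 0#           ≈⟨ +-congˡ (-‿inverseʳ x) ⟨
    d + (x + - x)    ≈⟨ +-assoc d x (- x) ⟨
    (d + x) + - x    ≈⟨ +-congʳ (+-comm d x) ⟩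
    (x + d) + - x    ≤⟨ +-monoˡ-≤ (- x) x+d≤x ⟩
    x + - x          ≈⟨ -‿inverseʳ x ⟩
    0#               ∎

  x+x≤0⇒x≈0 : ∀ {x} → 0# ≤ x → x + x ≤ 0# → x ≈ 0#
  x+x≤0⇒x≈0 {x} 0≤x x+x≤0 = antisym x≤0 0≤x
    where
    x≤0 : x ≤ 0#
    x≤0 = begin
      x      ≈⟨ +-identityʳ x ⟨
      x + 0# ≤⟨ +-monoʳ-≤ x 0≤x ⟩
      x + x  ≤⟨ x+x≤0 ⟩
      0#     ∎

  sumFin-+ : ∀ n (g h : Fin n → Carrier) →
             sumFin F n g + sumFin F n h ≈ sumFin F n (λ j → g j + h j)
  sumFin-+ zero    g h = +-identityˡ 0#
  sumFin-+ (suc n) g h = begin-equality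
    (g zero + sumFin F n (λ j → g (suc j))) + (h zero + sumFin F n (λ j → h (suc j)))
      ≈⟨ interchange _ _ _ _ ⟩
    (g zero + h zero) + (sumFin F n (λ j → g (suc j)) + sumFin F n (λ j → h (suc j)))
      ≈⟨ +-congˡ (sumFin-+ n (λ j → g (suc j)) (λ j → h (suc j))) ⟩
    (g zero + h zero) + sumFin F n (λ j → g (suc j) + h (suc j)) ∎

  sumFin-mono : ∀ n {g h : Fin n → Carrier} →
                (∀ j → g j ≤ h j) → sumFin F n g ≤ sumFin F n h
  sumFin-mono zero    g≤h = ≤-refl
  sumFin-mono (suc n) g≤h = +-mono-≤ (g≤h zero) (sumFin-mono n (λ j → g≤h (suc j)))

  sumFin-mono-slack : ∀ n {g h : Fin n → Carrier} (i : Fin n) d →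
                      (∀ j → g j ≤ h j) → g i + d ≤ h i →
                      sumFin F n g + d ≤ sumFin F n h
  sumFin-mono-slack (suc n) {g} {h} zero d g≤h gᵢ+d≤hᵢ = begin
    (g zero + sumFin F n (λ j → g (suc j))) + d ≈⟨ xy∙z≈xz∙y _ _ _ ⟩
    (g zero + d) + sumFin F n (λ j → g (suc j))
      ≤⟨ +-mono-≤ gᵢ+d≤hᵢ (sumFin-mono n (λ j → g≤h (suc j))) ⟩
    h zero + sumFin F n (λ j → h (suc j))       ∎
  sumFin-mono-slack (suc n) {g} {h} (suc i) d g≤h gᵢ+d≤hᵢ = begin
    (g zero + sumFin F n (λ j → g (suc j))) + d ≈⟨ +-assoc _ _ _ ⟩
    g zero + (sumFin F n (λ j → g (suc j)) + d)
      ≤⟨ +-mono-≤ (g≤h zero) (sumFin-mono-slack n i d (λ j → g≤h (suc j)) gᵢ+d≤hᵢ) ⟩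
    h zero + sumFin F n (λ j → h (suc j))       ∎

module XbarProperties {c ℓ₁ ℓ₂} (F : OrderedField c ℓ₁ ℓ₂) where

  open OrderedFieldProperties F

  xbarᵢ-supermodular : ∀ {k x} (l : Fin k) → 0# ≤ x → ∀ s t →
    xbarᵢ F x l s + xbarᵢ F x l t ≤ xbarᵢ F x l (s ⊓ t) + xbarᵢ F x l (s ⊔ t)
  xbarᵢ-supermodular l 0≤x o        t = ≤-refl
  xbarᵢ-supermodular l 0≤x (leaf a) o = ≤-reflexive (+-comm _ _)
  xbarᵢ-supermodular {x = x} l 0≤x (leaf a) (leaf b) with a ≟ b
  ... | yes refl = ≤-refl
  ... | no a≢b with a ≟ l | b ≟ l
  ...   | yes refl | yes refl = ⊥-elim (a≢b refl)
  ...   | yes _    | no _     = ≤-reflexive (≈-trans (-‿inverseʳ x) (≈-sym (+-identityˡ 0#)))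
  ...   | no _     | yes _    = ≤-reflexive (≈-trans (-‿inverseˡ x) (≈-sym (+-identityˡ 0#)))
  ...   | no _     | no _     = +-mono-≤ (neg-nonpos 0≤x) (neg-nonpos 0≤x)

  xbarᵢ-supermodular-slack : ∀ {k} x (l a b : Fin k) → a ≢ b → a ≢ l → b ≢ l →
    (xbarᵢ F x l (leaf a) + xbarᵢ F x l (leaf b)) + (x + x)
      ≈ xbarᵢ F x l (leaf a ⊓ leaf b) + xbarᵢ F x l (leaf a ⊔ leaf b)
  xbarᵢ-supermodular-slack x l a b a≢b a≢l b≢l with a ≟ b
  ... | yes a≡b = ⊥-elim (a≢b a≡b)
  ... | no _ with a ≟ l | b ≟ l
  ...   | yes a≡l | _       = ⊥-elim (a≢l a≡l)
  ...   | no _    | yes b≡l = ⊥-elim (b≢l b≡l)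
  ...   | no _    | no _    = begin-equality
    (- x + - x) + (x + x) ≈⟨ interchange (- x) (- x) x x ⟩
    (- x + x) + (- x + x) ≈⟨ +-cong (-‿inverseˡ x) (-‿inverseˡ x) ⟩
    0# + 0#               ∎

  xbar-supermodular-slack : ∀ {k n} (x : Fin n → Carrier) (L : Fin n → Fin k) →
    (∀ j → 0# ≤ x j) → (T U : Tn k n) (i : Fin n) (a b : Fin k) →
    T i ≡ leaf a → U i ≡ leaf b → a ≢ b → a ≢ L i → b ≢ L i →
    (xbar F x L T + xbar F x L U) + (x i + x i)
      ≤ xbar F x L (T ⊓ⁿ U) + xbar F x L (T ⊔ⁿ U)
  xbar-supermodular-slack {n = n} x L 0≤x T U i a b Tᵢ≡a Uᵢ≡b a≢b a≢Lᵢ b≢Lᵢ = begin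
    (xbar F x L T + xbar F x L U) + (x i + x i)
      ≈⟨ +-congʳ (sumFin-+ n _ _) ⟩
    sumFin F n (λ j → X j (T j) + X j (U j)) + (x i + x i)
      ≤⟨ sumFin-mono-slack n i _ (λ j → xbarᵢ-supermodular (L j) (0≤x j) (T j) (U j)) slackᵢ ⟩
    sumFin F n (λ j → X j (T j ⊓ U j) + X j (T j ⊔ U j))
      ≈⟨ sumFin-+ n _ _ ⟨
    xbar F x L (T ⊓ⁿ U) + xbar F x L (T ⊔ⁿ U) ∎
    where
    X : ∀ j → _ → Carrier
    X j = xbarᵢ F (x j) (L j)

    slackᵢ : (X i (T i) + X i (U i)) + (x i + x i) ≤ X i (T i ⊓ U i) + X i (T i ⊔ U i)
    slackᵢ rewrite Tᵢ≡a | Uᵢ≡b = ≤-reflexive (xbarᵢ-supermodular-slack (x i) (L i) a b a≢b a≢Lᵢ b≢Lᵢ)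

  tight-pair-off-leaves⇒≈0 : ∀ {k n} {f : Tn k n → Carrier} {x : Fin n → Carrier}
    {L : Fin n → Fin k} → IsKSubmodular F f → InU F f x L →
    (T U : Tn k n) (i : Fin n) (a b : Fin k) → InF F f x L T → InF F f x L U →
    T i ≡ leaf a → U i ≡ leaf b → a ≢ b → a ≢ L i → b ≢ L i → x i ≈ 0#
  tight-pair-off-leaves⇒≈0 {f = f} {x} {L} f-submodular (0≤x , xbar≤f) T U i a b
    T-tight U-tight Tᵢ≡a Uᵢ≡b a≢b a≢Lᵢ b≢Lᵢ =
    x+x≤0⇒x≈0 (0≤x i) (x+d≤x⇒d≤0 _ _ (begin
      (xbar F x L T + xbar F x L U) + (x i + x i)
        ≤⟨ xbar-supermodular-slack x L 0≤x T U i a b Tᵢ≡a Uᵢ≡b a≢b a≢Lᵢ b≢Lᵢ ⟩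
      xbar F x L (T ⊓ⁿ U) + xbar F x L (T ⊔ⁿ U)
        ≤⟨ +-mono-≤ (xbar≤f (T ⊓ⁿ U)) (xbar≤f (T ⊔ⁿ U)) ⟩
      f (T ⊓ⁿ U) + f (T ⊔ⁿ U)     ≤⟨ f-submodular T U ⟩
      f T + f U                   ≈⟨ +-cong T-tight U-tight ⟨
      xbar F x L T + xbar F x L U ∎))

-- Imported only here, so that it does not clash with the field order above.
open import Data.Nat using (_≤_)

lemma3 : ∀ {c ℓ₁ ℓ₂ : Level} (F : OrderedField c ℓ₁ ℓ₂) (k n : ℕ) → 2 ≤ k → 1 ≤ n →
    (f : Tn k n → OrderedField.Carrier F) →
    IsKSubmodular F f → OrderedField._≈_ F (f 𝟎) (OrderedField.0# F) →
    (x : Fin n → OrderedField.Carrier F) (L : Fin n → Fin k) → InU F f x L →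
    (T U : Tn k n) (i : Fin n) →
    InF F f x L T → InF F f x L U → InSupp F x i →
    (a b : Fin k) → T i ≡ leaf a → U i ≡ leaf b → a ≢ L i → b ≢ L i →
    a ≡ b
lemma3 F k n _ _ f f-submodular _ x L x∈U T U i T-tight U-tight i∈supp a b Tᵢ≡a Uᵢ≡b a≢Lᵢ b≢Lᵢ
  with a ≟ b
... | yes a≡b = a≡b
... | no a≢b  = ⊥-elim (i∈supp (XbarProperties.tight-pair-off-leaves⇒≈0 F f-submodular x∈U
                  T U i a b T-tight U-tight Tᵢ≡a Uᵢ≡b a≢b a≢Lᵢ b≢Lᵢ))
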